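{- Let $G$ be a connected graph of order $n$ and $k$ an integer with $n-\kappa(G)+1\leq k\leq n$ (and $k\ge 2$). Then $sdiam_k(G)=k-1$.
   Context: $\kappa(G)$ is the vertex connectivity of $G$. For a connected graph $F$ and $S\subseteq V(F)$, the Steiner distance $d_F(S)$ is the minimum number of edges of a connected subgraph of $F$ whose vertex set contains $S$; for $2\le k\le |V(F)|$, $sdiam_k(F)=\max\{d_F(S): S\subseteq V(F),\ |S|=k\}$. -}

module Defs where

open import Data.Nat using (ℕ; zero; suc; _+_; _∸_; _≤_; _<ᵇ_)
open import Data.Bool using (Bool; true; false; _∧_; if_then_else_)
open import Data.Fin using (Fin; toℕ)
open import Data.Fin.Subset using (Subset; _∈_; _∉_; _⊆_; ∣_∣)
open import Data.List using (List; map; allFin)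
open import Data.Nat.ListAction using (sum)
open import Data.Product using (Σ; _×_; _,_; ∃)
open import Data.Sum using (_⊎_)
open import Relation.Binary.PropositionalEquality using (_≡_; _≢_)
open import Relation.Nullary using (¬_)

record Graph (n : ℕ) : Set where
  field
    Adj    : Fin n → Fin n → Bool
    sym    : ∀ u v → Adj u v ≡ Adj v u
    irrefl : ∀ v → Adj v v ≡ false
open Graph public

data Reach {n : ℕ} (R : Fin n → Fin n → Set) : Fin n → Fin n → Set where
  here : ∀ {u} → Reach R u u
  step : ∀ {u v w} → R u v → Reach R v w → Reach R u w

Edge : ∀ {n} → Graph n → Fin n → Fin n → Set
Edge G u v = Adj G u v ≡ true

Connected : ∀ {n} → Graph n → Set
Connected G = ∀ u v → Reach (Edge G) u v

EdgeAvoid : ∀ {n} → Graph n → Subset n → Fin n → Fin n → Set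
EdgeAvoid G X u v = Edge G u v × u ∉ X × v ∉ X

DisconnectedOrTrivial : ∀ {n} → Graph n → Subset n → Set
DisconnectedOrTrivial {n} G X =
  (n ∸ ∣ X ∣ ≤ 1) ⊎
  Σ (Fin n) λ u → Σ (Fin n) λ v → u ∉ X × v ∉ X × ¬ Reach (EdgeAvoid G X) u v

IsVertexConnectivity : ∀ {n} → Graph n → ℕ → Set
IsVertexConnectivity {n} G c =
  (Σ (Subset n) λ X → ∣ X ∣ ≡ c × DisconnectedOrTrivial G X) ×
  (∀ (X : Subset n) → DisconnectedOrTrivial G X → c ≤ ∣ X ∣)

record Subgraph {n : ℕ} (G : Graph n) : Set where
  field
    W      : Subset n
    E      : Fin n → Fin n → Bool
    Esym   : ∀ u v → E u v ≡ E v u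
    Esub   : ∀ u v → E u v ≡ true → Adj G u v ≡ true
    Eends  : ∀ u v → E u v ≡ true → u ∈ W
open Subgraph public

edgeCount : ∀ {n} {G : Graph n} → Subgraph G → ℕ
edgeCount {n} H =
  sum (map (λ u → sum (map (λ v → if (toℕ u <ᵇ toℕ v) ∧ E H u v then 1 else 0)
                           (allFin n)))
           (allFin n))

ConnectedSub : ∀ {n} {G : Graph n} → Subgraph G → Set
ConnectedSub H = ∀ u v → u ∈ W H → v ∈ W H → Reach (λ a b → E H a b ≡ true) u v

IsSteinerDistance : ∀ {n} → Graph n → Subset n → ℕ → Set
IsSteinerDistance G S m =
  (Σ (Subgraph G) λ H → ConnectedSub H × S ⊆ W H × edgeCount H ≡ m) ×
  (∀ (H : Subgraph G) → ConnectedSub H → S ⊆ W H → m ≤ edgeCount H)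

IsSteinerDiameter : ∀ {n} → Graph n → ℕ → ℕ → Set
IsSteinerDiameter {n} G k m =
  (Σ (Subset n) λ S → ∣ S ∣ ≡ k × IsSteinerDistance G S m) ×
  (∀ (S : Subset n) (d : ℕ) → ∣ S ∣ ≡ k → IsSteinerDistance G S d → d ≤ m)

-- Every k-set S has Steiner distance exactly k - 1.
--  * Lower bound: a connected subgraph H on a nonempty vertex set W has at
--    least |W| - 1 edges.  Grow a set T from one vertex of W along edges of H,
--    keeping |T| ≤ 1 + #(edges of H inside T); connectivity of H always
--    supplies an edge leaving T until T = W.
--  * Upper bound: the complement of S has n - k < κ(G) vertices, so deleting it
--    leaves G[S] connected.  Growing a tree inside G[S] from one vertex of S
--    (again following an edge that leaves the current vertex set) gives a
--    connected subgraph on exactly S with at most |S| - 1 edges.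
-- Both growth processes are upward inductions on cardinality, and both rest on
-- two counting facts about unordered pairs: adding one pair raises the count
-- by at most one, and gaining one pair raises it by at least one.
-- Since k ≤ n some k-set exists, so the maximum of d_G(S) over k-sets is k - 1.
module Submission where

open import Defs hiding (sym)
open import Data.Nat using (ℕ; zero; suc; _+_; _∸_; _≤_; _<_; _<ᵇ_; z≤n; s≤s; pred)
open import Data.Nat.Properties
  using (≤-refl; ≤-trans; ≤-reflexive; ≤-antisym; <-irrefl; <-asym; <-cmp; <⇒≱; ≰⇒>;
         +-comm; +-suc; +-mono-≤; +-mono-<-≤; +-mono-≤-<; ∸-monoˡ-≤; ∸-monoʳ-≤; ∸-monoʳ-<;
         m∸[m∸n]≡n; <ᵇ⇒<; <⇒<ᵇ; module ≤-Reasoning)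
open import Relation.Binary.Definitions using (tri<; tri≈; tri>)
open import Data.Nat.Induction using (<-wellFounded)
open import Data.Nat.ListAction using (sum)
open import Data.Bool as Bool using (Bool; true; false; _∧_; _∨_; if_then_else_)
open import Data.Bool.Properties using (∧-comm; ∨-comm; ∨-zeroʳ; T-≡)
open import Data.Fin using (Fin; zero; suc; toℕ; _≟_)
open import Data.Fin.Properties using (any?; toℕ-injective; suc-injective)
open import Data.Fin.Subset using (Subset; _∈_; _∉_; _⊆_; ∣_∣; ⁅_⁆; _∪_; ∁; Nonempty; inside; outside)
open import Data.Fin.Subset.Properties
  using (_∈?_; nonempty?; Empty-unique; ∣⊥∣≡0; x∈⁅x⁆; x∈⁅y⁆⇒x≡y; ∣⁅x⁆∣≡1; ∣p∣≤n;
         p⊆q⇒∣p∣≤∣q∣; ⊆-antisym; x∈p⇒x∉∁p; x∉∁p⇒x∈p; ∣∁p∣≡n∸∣p∣; p⊆p∪q; q⊆p∪q;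
         x∈p∪q⁻; ∪-identityʳ)
open import Data.List using (map; allFin; tabulate)
open import Data.List.Properties using (map-tabulate)
open import Data.Vec using (_∷_; lookup; here; there)
open import Data.Vec.Properties using ([]=⇒lookup; lookup⇒[]=)
open import Data.Product using (Σ; _×_; _,_; proj₁; proj₂)
open import Data.Sum using (_⊎_; inj₁; inj₂; [_,_]′)
import Data.Sum as Sum
open import Data.Empty using (⊥-elim)
open import Function using (_∘_; id)
open import Function.Bundles using (Equivalence)
open import Induction.WellFounded using (module All)
import Relation.Binary.Construct.On as On
open import Relation.Binary.PropositionalEquality
open import Relation.Nullary using (¬_; Dec; yes; no; does; contradiction; ¬?)
open import Relation.Nullary.Decidable using (_×-dec_; dec-true; decidable-stable)

private
  variable
    n : ℕ

∑ : (Fin n → ℕ) → ℕ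
∑ {zero}  f = 0
∑ {suc n} f = f zero + ∑ (f ∘ suc)

sum-allFin : (f : Fin n → ℕ) → sum (map f (allFin n)) ≡ ∑ f
sum-allFin f = trans (cong sum (map-tabulate id f)) (sum-tabulate f)
  where
  sum-tabulate : ∀ {m} (g : Fin m → ℕ) → sum (tabulate g) ≡ ∑ g
  sum-tabulate {zero}  g = refl
  sum-tabulate {suc m} g = cong (g zero +_) (sum-tabulate (g ∘ suc))

∑-cong : {f g : Fin n → ℕ} → (∀ i → f i ≡ g i) → ∑ f ≡ ∑ g
∑-cong {zero}  eq = refl
∑-cong {suc n} eq = cong₂ _+_ (eq zero) (∑-cong (eq ∘ suc))

∑-zero : {f : Fin n → ℕ} → (∀ i → f i ≡ 0) → ∑ f ≡ 0
∑-zero {zero}  z = refl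
∑-zero {suc n} z = cong₂ _+_ (z zero) (∑-zero (z ∘ suc))

∑-mono : {f g : Fin n → ℕ} → (∀ i → f i ≤ g i) → ∑ f ≤ ∑ g
∑-mono {zero}  le = z≤n
∑-mono {suc n} le = +-mono-≤ (le zero) (∑-mono (le ∘ suc))

∑-strict : {f g : Fin n → ℕ} → (∀ i → f i ≤ g i) → (j : Fin n) → f j < g j → ∑ f < ∑ g
∑-strict le zero    lt = +-mono-<-≤ lt (∑-mono (le ∘ suc))
∑-strict le (suc j) lt = +-mono-≤-< (le zero) (∑-strict (le ∘ suc) j lt)

∑-except : {f g : Fin n → ℕ} (j : Fin n) → (∀ i → i ≢ j → f i ≤ g i) →
           f j ≤ suc (g j) → ∑ f ≤ suc (∑ g)
∑-except zero le at = +-mono-≤ at (∑-mono (λ i → le (suc i) λ ()))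
∑-except {g = g} (suc j) le at =
  ≤-trans (+-mono-≤ (le zero λ ()) (∑-except j (λ i i≢j → le (suc i) (i≢j ∘ suc-injective)) at))
          (≤-reflexive (+-suc (g zero) _))

∑² : (Fin n → Fin n → ℕ) → ℕ
∑² f = ∑ λ u → ∑ (f u)

∑²-mono : {f g : Fin n → Fin n → ℕ} → (∀ u v → f u v ≤ g u v) → ∑² f ≤ ∑² g
∑²-mono le = ∑-mono λ u → ∑-mono (le u)

∑²-strict : {f g : Fin n → Fin n → ℕ} (lo hi : Fin n) → (∀ u v → f u v ≤ g u v) →
            f lo hi < g lo hi → ∑² f < ∑² g
∑²-strict lo hi le lt = ∑-strict (λ u → ∑-mono (le u)) lo (∑-strict (le lo) hi lt)

∑²-except : {f g : Fin n → Fin n → ℕ} (lo hi : Fin n) →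
            (∀ u v → ¬ (u ≡ lo × v ≡ hi) → f u v ≤ g u v) →
            f lo hi ≤ suc (g lo hi) → ∑² f ≤ suc (∑² g)
∑²-except lo hi le at =
  ∑-except lo (λ u u≢lo → ∑-mono λ v → le u v (u≢lo ∘ proj₁))
              (∑-except hi (λ v v≢hi → le lo v (v≢hi ∘ proj₂)) at)

∧-true⁻ : ∀ x {y} → x ∧ y ≡ true → x ≡ true × y ≡ true
∧-true⁻ true {true} _ = refl , refl

∧-true⁺ : ∀ {x y} → x ≡ true → y ≡ true → x ∧ y ≡ true
∧-true⁺ refl refl = refl

∨-true⁻ : ∀ x {y} → x ∨ y ≡ true → x ≡ true ⊎ y ≡ true
∨-true⁻ true         _ = inj₁ refl
∨-true⁻ false {true} _ = inj₂ refl

does-sound : ∀ {p} {P : Set p} (d : Dec P) → does d ≡ true → P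
does-sound (yes p) _ = p

𝟙 : Bool → ℕ
𝟙 b = if b then 1 else 0

𝟙-mono : ∀ {x y} → (x ≡ true → y ≡ true) → 𝟙 x ≤ 𝟙 y
𝟙-mono {false}        _ = z≤n
𝟙-mono {true} {true}  _ = ≤-refl
𝟙-mono {true} {false} h = contradiction (h refl) λ ()

𝟙-strict : ∀ {x y} → ¬ x ≡ true → y ≡ true → 𝟙 x < 𝟙 y
𝟙-strict {false} _ refl = s≤s z≤n
𝟙-strict {true}  x≢t _  = contradiction refl x≢t

𝟙-false : ∀ {x} → ¬ x ≡ true → 𝟙 x ≡ 0
𝟙-false {false} _   = refl
𝟙-false {true}  x≢t = contradiction refl x≢t

𝟙≤1 : ∀ x → 𝟙 x ≤ 1
𝟙≤1 false = z≤n
𝟙≤1 true  = ≤-refl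

-- Strict order of vertices; each unordered pair {u , v} is counted once,
-- in its increasing listing.
_≺_ : Fin n → Fin n → Bool
u ≺ v = toℕ u <ᵇ toℕ v

≺-sound : ∀ {u v : Fin n} → u ≺ v ≡ true → toℕ u < toℕ v
≺-sound {u = u} {v} h = <ᵇ⇒< (toℕ u) (toℕ v) (Equivalence.from T-≡ h)

≺-complete : ∀ {u v : Fin n} → toℕ u < toℕ v → u ≺ v ≡ true
≺-complete lt = Equivalence.to T-≡ (<⇒<ᵇ lt)

SymmetricB : (Fin n → Fin n → Bool) → Set
SymmetricB R = ∀ u v → R u v ≡ R v u

_⊆ᵇ_ : (Fin n → Fin n → Bool) → (Fin n → Fin n → Bool) → Set
R ⊆ᵇ R′ = ∀ u v → R u v ≡ true → R′ u v ≡ true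

pairCount : (Fin n → Fin n → Bool) → ℕ
pairCount R = ∑² λ u v → 𝟙 (u ≺ v ∧ R u v)

edgeCount≡pairCount : ∀ {G : Graph n} (H : Subgraph G) → edgeCount H ≡ pairCount (E H)
edgeCount≡pairCount {n} H =
  trans (sum-allFin (λ u → sum (map (λ v → 𝟙 (u ≺ v ∧ E H u v)) (allFin n))))
        (∑-cong λ u → sum-allFin (λ v → 𝟙 (u ≺ v ∧ E H u v)))

pairTerm-mono : {R R′ : Fin n → Fin n → Bool} → R ⊆ᵇ R′ →
                ∀ u v → 𝟙 (u ≺ v ∧ R u v) ≤ 𝟙 (u ≺ v ∧ R′ u v)
pairTerm-mono R⊆R′ u v = 𝟙-mono λ h →
  let (u≺v , r) = ∧-true⁻ (u ≺ v) h in ∧-true⁺ u≺v (R⊆R′ u v r)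

pairCount-mono : {R R′ : Fin n → Fin n → Bool} → R ⊆ᵇ R′ → pairCount R ≤ pairCount R′
pairCount-mono R⊆R′ = ∑²-mono (pairTerm-mono R⊆R′)

pairCount-none : {R : Fin n → Fin n → Bool} → (∀ u v → ¬ R u v ≡ true) → pairCount R ≡ 0
pairCount-none none =
  ∑-zero λ u → ∑-zero λ v → 𝟙-false λ h → none u v (proj₂ (∧-true⁻ (u ≺ v) h))

SamePair : Fin n → Fin n → Fin n → Fin n → Set
SamePair a c u v = (u ≡ a × v ≡ c) ⊎ (u ≡ c × v ≡ a)

orient : ∀ {a c : Fin n} → a ≢ c →
         Σ (Fin n) λ lo → Σ (Fin n) λ hi → SamePair a c lo hi × toℕ lo < toℕ hi
orient {a = a} {c} a≢c with <-cmp (toℕ a) (toℕ c)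
... | tri< a<c _ _ = a , c , inj₁ (refl , refl) , a<c
... | tri≈ _ a≡c _ = contradiction (toℕ-injective a≡c) a≢c
... | tri> _ _ c<a = c , a , inj₂ (refl , refl) , c<a

increasing-unique : ∀ {a c u v lo hi : Fin n} → SamePair a c u v → SamePair a c lo hi →
                    toℕ u < toℕ v → toℕ lo < toℕ hi → u ≡ lo × v ≡ hi
increasing-unique (inj₁ (refl , refl)) (inj₁ (refl , refl)) _ _ = refl , refl
increasing-unique (inj₂ (refl , refl)) (inj₂ (refl , refl)) _ _ = refl , refl
increasing-unique (inj₁ (refl , refl)) (inj₂ (refl , refl)) p q = contradiction q (<-asym p)
increasing-unique (inj₂ (refl , refl)) (inj₁ (refl , refl)) p q = contradiction q (<-asym p)

samePair-value : ∀ {R : Fin n → Fin n → Bool} {a c u v} → SymmetricB R →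
                 SamePair a c u v → R u v ≡ R a c
samePair-value symR (inj₁ (refl , refl)) = refl
samePair-value symR (inj₂ (refl , refl)) = symR _ _

pairᵇ : Fin n → Fin n → Fin n → Fin n → Bool
pairᵇ a c u v = (does (u ≟ a) ∧ does (v ≟ c)) ∨ (does (u ≟ c) ∧ does (v ≟ a))

pairᵇ-sound : ∀ {a c u v : Fin n} → pairᵇ a c u v ≡ true → SamePair a c u v
pairᵇ-sound {a = a} {c} {u} {v} h with ∨-true⁻ (does (u ≟ a) ∧ does (v ≟ c)) h
... | inj₁ p = let (ua , vc) = ∧-true⁻ (does (u ≟ a)) p
               in inj₁ (does-sound (u ≟ a) ua , does-sound (v ≟ c) vc)
... | inj₂ p = let (uc , va) = ∧-true⁻ (does (u ≟ c)) p
               in inj₂ (does-sound (u ≟ c) uc , does-sound (v ≟ a) va)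

pairᵇ-complete : ∀ {a c u v : Fin n} → SamePair a c u v → pairᵇ a c u v ≡ true
pairᵇ-complete {a = a} {c} (inj₁ (refl , refl))
  rewrite dec-true (a ≟ a) refl | dec-true (c ≟ c) refl = refl
pairᵇ-complete {a = a} {c} (inj₂ (refl , refl))
  rewrite dec-true (a ≟ a) refl | dec-true (c ≟ c) refl = ∨-zeroʳ _

pairᵇ-sym : (a c : Fin n) → SymmetricB (pairᵇ a c)
pairᵇ-sym a c u v =
  trans (cong₂ _∨_ (∧-comm (does (u ≟ a)) _) (∧-comm (does (u ≟ c)) _))
        (∨-comm (does (v ≟ c) ∧ does (u ≟ a)) _)

pairCount-extend : {R R′ : Fin n → Fin n → Bool} {a c : Fin n} → a ≢ c →
                   (∀ u v → R′ u v ≡ true → R u v ≡ true ⊎ SamePair a c u v) →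
                   pairCount R′ ≤ suc (pairCount R)
pairCount-extend {R = R} {R′} a≢c R′⊆R+ac with orient a≢c
... | lo , hi , lohi , lo<hi = ∑²-except lo hi away (≤-trans (𝟙≤1 _) (s≤s z≤n))
  where
  away : ∀ u v → ¬ (u ≡ lo × v ≡ hi) → 𝟙 (u ≺ v ∧ R′ u v) ≤ 𝟙 (u ≺ v ∧ R u v)
  away u v not-lohi = 𝟙-mono λ h →
    let (u≺v , r′) = ∧-true⁻ (u ≺ v) h
        not-ac = λ uv → not-lohi (increasing-unique uv lohi (≺-sound u≺v) lo<hi)
    in ∧-true⁺ u≺v ([ id , (λ uv → ⊥-elim (not-ac uv)) ]′ (R′⊆R+ac u v r′))

pairCount-grow : {R R′ : Fin n → Fin n → Bool} {a c : Fin n} → SymmetricB R → SymmetricB R′ →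
                 R ⊆ᵇ R′ → ¬ R a c ≡ true → R′ a c ≡ true →
                 a ≢ c → pairCount R < pairCount R′
pairCount-grow {R = R} {R′} symR symR′ R⊆R′ ¬Rac R′ac a≢c with orient a≢c
... | lo , hi , lohi , lo<hi =
  ∑²-strict lo hi (pairTerm-mono R⊆R′)
                  (𝟙-strict (λ h → ¬Rac (trans (sym (samePair-value symR lohi)) (proj₂ (∧-true⁻ (lo ≺ hi) h))))
                            (∧-true⁺ (≺-complete lo<hi) (trans (samePair-value symR′ lohi) R′ac)))

card-add : (p : Subset n) {c : Fin n} → c ∉ p → ∣ p ∪ ⁅ c ⁆ ∣ ≡ suc ∣ p ∣
card-add (outside ∷ p) {zero}  _   = cong (suc ∘ ∣_∣) (∪-identityʳ p)
card-add (inside ∷ p)  {zero}  c∉p = contradiction here c∉p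
card-add (outside ∷ p) {suc c} c∉p = card-add p (c∉p ∘ there)
card-add (inside ∷ p)  {suc c} c∉p = cong suc (card-add p (c∉p ∘ there))

∈-∪⁅⁆⁻ : ∀ (p : Subset n) {c x} → x ∈ p ∪ ⁅ c ⁆ → x ∈ p ⊎ x ≡ c
∈-∪⁅⁆⁻ p {c} x∈ = Sum.map₂ (x∈⁅y⁆⇒x≡y c) (x∈p∪q⁻ p ⁅ c ⁆ x∈)

subsetOfSize : ∀ {k} → k ≤ n → Σ (Subset n) λ S → ∣ S ∣ ≡ k
subsetOfSize {n} {zero} _ = Data.Fin.Subset.⊥ , ∣⊥∣≡0 n
subsetOfSize {suc n} {suc k} (s≤s k≤n) =
  let (S , ∣S∣≡k) = subsetOfSize k≤n in inside ∷ S , cong suc ∣S∣≡k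

nonempty-of-size : (p : Subset n) → 0 < ∣ p ∣ → Nonempty p
nonempty-of-size {n} p pos with nonempty? p
... | yes ne    = ne
... | no empty  = contradiction (subst (0 <_) (trans (cong ∣_∣ (Empty-unique empty)) (∣⊥∣≡0 n)) pos)
                                (<-irrefl refl)

⊆-or-escapes : (p q : Subset n) → p ⊆ q ⊎ Σ (Fin n) λ x → x ∈ p × x ∉ q
⊆-or-escapes p q with any? (λ x → (x ∈? p) ×-dec ¬? (x ∈? q))
... | yes escape = inj₂ escape
... | no none    = inj₁ λ {x} x∈p → decidable-stable (x ∈? q) λ x∉q → none (x , x∈p , x∉q)

Reach-map : ∀ {R R′ : Fin n → Fin n → Set} → (∀ {a b} → R a b → R′ a b) →
            ∀ {u v} → Reach R u v → Reach R′ u v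
Reach-map f here         = here
Reach-map f (step r rest) = step (f r) (Reach-map f rest)

Reach-trans : ∀ {R : Fin n → Fin n → Set} {u v w} → Reach R u v → Reach R v w → Reach R u w
Reach-trans here          q = q
Reach-trans (step r rest) q = step r (Reach-trans rest q)

Crossing : (Fin n → Fin n → Set) → Subset n → Set
Crossing {n} R T = Σ (Fin n) λ a → Σ (Fin n) λ c → a ∈ T × c ∉ T × R a c

crossing : ∀ {R : Fin n → Fin n → Set} {T u w} → u ∈ T → w ∉ T → Reach R u w → Crossing R T
crossing u∈T w∉T here = contradiction u∈T w∉T
crossing {T = T} u∈T w∉T (step {v = v} r rest) with v ∈? T
... | yes v∈T = crossing v∈T w∉T rest
... | no  v∉T = _ , v , u∈T , v∉T , r

-- For a decidable relation, a boundary edge can be found as soon as a walk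
-- cannot fail to exist (search all pairs; if none crosses, no walk exists).
crossing-¬¬ : ∀ {R : Fin n → Fin n → Set} {T u w} → (∀ a c → Dec (R a c)) →
              u ∈ T → w ∉ T → ¬ ¬ Reach R u w → Crossing R T
crossing-¬¬ {T = T} R? u∈T w∉T ¬¬walk
  with any? (λ a → any? λ c → (a ∈? T) ×-dec ¬? (c ∈? T) ×-dec R? a c)
... | yes (a , c , edge) = a , c , edge
... | no none = ⊥-elim (¬¬walk λ walk → none (crossing u∈T w∉T walk))

-- G[S] = G - (V ∖ S) is connected: any two vertices of S are joined by a walk
-- avoiding V ∖ S, up to double negation (which is what the minimality in the
-- definition of κ(G) yields).
InducedConnected : Graph n → Subset n → Set
InducedConnected G S = ∀ u v → u ∈ S → v ∈ S → ¬ ¬ Reach (EdgeAvoid G (∁ S)) u v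

upwardInduction : ∀ {a p} {A : Set a} (μ : A → ℕ) → (∀ x → μ x ≤ n) → (P : A → Set p) →
                  (∀ x → (∀ y → μ x < μ y → P y) → P x) → ∀ x → P x
upwardInduction {n} μ bounded P ind =
  All.wfRec (On.wellFounded (λ x → n ∸ μ x) <-wellFounded) _ P
    λ x rec → ind x λ y μx<μy → rec (∸-monoʳ-< μx<μy (bounded y))

module LowerBound {G : Graph n} (H : Subgraph G) (connH : ConnectedSub H) (t : Fin n) where

  EdgeIn : Subset n → Fin n → Fin n → Bool
  EdgeIn T u v = E H u v ∧ (lookup T u ∧ lookup T v)

  edgesIn : Subset n → ℕ
  edgesIn T = pairCount (EdgeIn T)

  edgesIn≤edgeCount : ∀ T → edgesIn T ≤ edgeCount H
  edgesIn≤edgeCount T = subst (edgesIn T ≤_) (sym (edgeCount≡pairCount H))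
                              (pairCount-mono λ u v h → proj₁ (∧-true⁻ (E H u v) h))

  edgesIn-grow : ∀ T {a c} → a ∈ T → c ∉ T → E H a c ≡ true → edgesIn T < edgesIn (T ∪ ⁅ c ⁆)
  edgesIn-grow T {a} {c} a∈T c∉T eac =
    pairCount-grow (sym-EdgeIn T) (sym-EdgeIn T′) EdgeIn-mono ¬in-T in-T′ (λ { refl → c∉T a∈T })
    where
    T′ = T ∪ ⁅ c ⁆
    sym-EdgeIn : ∀ X → SymmetricB (EdgeIn X)
    sym-EdgeIn X u v = cong₂ _∧_ (Esym H u v) (∧-comm (lookup X u) (lookup X v))
    T⊆T′ : ∀ {x} → lookup T x ≡ true → lookup T′ x ≡ true
    T⊆T′ {x} h = []=⇒lookup (p⊆p∪q ⁅ c ⁆ (lookup⇒[]= x T h))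
    EdgeIn-mono : EdgeIn T ⊆ᵇ EdgeIn T′
    EdgeIn-mono u v h = let (e , ends) = ∧-true⁻ (E H u v) h ; (tu , tv) = ∧-true⁻ (lookup T u) ends
                        in ∧-true⁺ e (∧-true⁺ (T⊆T′ tu) (T⊆T′ tv))
    ¬in-T : ¬ EdgeIn T a c ≡ true
    ¬in-T h = c∉T (lookup⇒[]= c T (proj₂ (∧-true⁻ (lookup T a) (proj₂ (∧-true⁻ (E H a c) h)))))
    in-T′ : EdgeIn T′ a c ≡ true
    in-T′ = ∧-true⁺ eac (∧-true⁺ (T⊆T′ ([]=⇒lookup a∈T)) ([]=⇒lookup (q⊆p∪q T ⁅ c ⁆ (x∈⁅x⁆ c))))

  Grows : Subset n → Set
  Grows T = t ∈ T → T ⊆ W H → ∣ T ∣ ≤ suc (edgesIn T) → ∣ W H ∣ ≤ suc (edgeCount H)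

  grow : ∀ T → Grows T
  grow = upwardInduction ∣_∣ ∣p∣≤n Grows growStep
    where
    growStep : ∀ T → (∀ T′ → ∣ T ∣ < ∣ T′ ∣ → Grows T′) → Grows T
    growStep T ih t∈T T⊆W inv with ⊆-or-escapes (W H) T
    ... | inj₁ W⊆T = ≤-trans (p⊆q⇒∣p∣≤∣q∣ W⊆T) (≤-trans inv (s≤s (edgesIn≤edgeCount T)))
    ... | inj₂ (w , w∈W , w∉T) with crossing t∈T w∉T (connH t w (T⊆W t∈T) w∈W)
    ... | a , c , a∈T , c∉T , eac =
      ih T′ (≤-reflexive (sym (card-add T c∉T))) (p⊆p∪q ⁅ c ⁆ t∈T) T′⊆W inv′
      where
      T′ = T ∪ ⁅ c ⁆
      T′⊆W : T′ ⊆ W H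
      T′⊆W x∈ with ∈-∪⁅⁆⁻ T x∈
      ... | inj₁ x∈T  = T⊆W x∈T
      ... | inj₂ refl = Eends H c a (trans (Esym H c a) eac)
      inv′ : ∣ T′ ∣ ≤ suc (edgesIn T′)
      inv′ = subst (_≤ suc (edgesIn T′)) (sym (card-add T c∉T))
                   (s≤s (≤-trans inv (edgesIn-grow T a∈T c∉T eac)))

connected-edges : ∀ {G : Graph n} (H : Subgraph G) → ConnectedSub H → ∀ {t} → t ∈ W H →
                  ∣ W H ∣ ≤ suc (edgeCount H)
connected-edges H connH {t} t∈W =
  grow ⁅ t ⁆ (x∈⁅x⁆ t) (λ x∈ → subst (_∈ W H) (sym (x∈⁅y⁆⇒x≡y t x∈)) t∈W)
       (≤-trans (≤-reflexive (∣⁅x⁆∣≡1 t)) (s≤s z≤n))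
  where open LowerBound H connH t

point : ∀ {G : Graph n} → Fin n → Subgraph G
point s = record { W = ⁅ s ⁆ ; E = λ _ _ → false ; Esym = λ _ _ → refl
                 ; Esub = λ _ _ () ; Eends = λ _ _ () }

point-connected : ∀ {G : Graph n} s → ConnectedSub (point {G = G} s)
point-connected s u v u∈ v∈ rewrite x∈⁅y⁆⇒x≡y s u∈ | x∈⁅y⁆⇒x≡y s v∈ = here

point-edgeCount : ∀ {G : Graph n} s → edgeCount (point {G = G} s) ≡ 0
point-edgeCount {n} {G} s =
  trans (edgeCount≡pairCount (point {G = G} s)) (pairCount-none {n} {λ _ _ → false} λ _ _ ())

module Extend {G : Graph n} (H : Subgraph G) {a c : Fin n}
              (ac : Edge G a c) (a∈W : a ∈ W H) (c∉W : c ∉ W H) where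

  E⁺ : Fin n → Fin n → Bool
  E⁺ u v = E H u v ∨ pairᵇ a c u v

  H⁺ : Subgraph G
  H⁺ = record
    { W     = W H ∪ ⁅ c ⁆
    ; E     = E⁺
    ; Esym  = λ u v → cong₂ _∨_ (Esym H u v) (pairᵇ-sym a c u v)
    ; Esub  = λ u v h → [ Esub H u v , onPair u v ∘ pairᵇ-sound ]′ (∨-true⁻ (E H u v) h)
    ; Eends = λ u v h → [ p⊆p∪q ⁅ c ⁆ ∘ Eends H u v , endOnPair u v ∘ pairᵇ-sound ]′ (∨-true⁻ (E H u v) h)
    }
    where
    onPair : ∀ u v → SamePair a c u v → Adj G u v ≡ true
    onPair _ _ (inj₁ (refl , refl)) = ac
    onPair _ _ (inj₂ (refl , refl)) = trans (Graph.sym G c a) ac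
    endOnPair : ∀ u v → SamePair a c u v → u ∈ W H ∪ ⁅ c ⁆
    endOnPair _ _ (inj₁ (refl , refl)) = p⊆p∪q ⁅ c ⁆ a∈W
    endOnPair _ _ (inj₂ (refl , refl)) = q⊆p∪q (W H) ⁅ c ⁆ (x∈⁅x⁆ c)

  old : ∀ {x y} → Reach (λ p q → E H p q ≡ true) x y → Reach (λ p q → E⁺ p q ≡ true) x y
  old = Reach-map λ e → cong (_∨ _) e

  a→c : E⁺ a c ≡ true
  a→c = trans (cong (E H a c ∨_) (pairᵇ-complete {a = a} {c} (inj₁ (refl , refl)))) (∨-zeroʳ _)

  c→a : E⁺ c a ≡ true
  c→a = trans (cong (E H c a ∨_) (pairᵇ-complete {a = a} {c} (inj₂ (refl , refl)))) (∨-zeroʳ _)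

  connected⁺ : ConnectedSub H → ConnectedSub H⁺
  connected⁺ connH u v u∈ v∈ with ∈-∪⁅⁆⁻ (W H) u∈ | ∈-∪⁅⁆⁻ (W H) v∈
  ... | inj₁ u∈W  | inj₁ v∈W  = old (connH u v u∈W v∈W)
  ... | inj₁ u∈W  | inj₂ refl = Reach-trans (old (connH u a u∈W a∈W)) (step a→c here)
  ... | inj₂ refl | inj₁ v∈W  = step c→a (old (connH a v a∈W v∈W))
  ... | inj₂ refl | inj₂ refl = here

  edgeCount⁺ : edgeCount H⁺ ≤ suc (edgeCount H)
  edgeCount⁺ = begin
    edgeCount H⁺          ≡⟨ edgeCount≡pairCount H⁺ ⟩
    pairCount E⁺          ≤⟨ pairCount-extend (λ { refl → c∉W a∈W })
                                              (λ u v h → Sum.map₂ pairᵇ-sound (∨-true⁻ (E H u v) h)) ⟩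
    suc (pairCount (E H)) ≡⟨ cong suc (sym (edgeCount≡pairCount H)) ⟩
    suc (edgeCount H)     ∎
    where open ≤-Reasoning

module SpanningTree {G : Graph n} (S : Subset n)
       (connS : InducedConnected G S) where

  record PartialTree : Set where
    field
      tree      : Subgraph G
      connected : ConnectedSub tree
      within    : W tree ⊆ S
      root      : Fin n
      root∈     : root ∈ W tree
      sparse    : suc (edgeCount tree) ≤ ∣ W tree ∣

  size : PartialTree → ℕ
  size P = ∣ W (PartialTree.tree P) ∣

  seed : ∀ {s} → s ∈ S → PartialTree
  seed {s} s∈S = record
    { tree = point s ; connected = point-connected {G = G} s
    ; within = λ x∈ → subst (_∈ S) (sym (x∈⁅y⁆⇒x≡y s x∈)) s∈S
    ; root = s ; root∈ = x∈⁅x⁆ s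
    ; sparse = subst₂ _≤_ (cong suc (sym (point-edgeCount {G = G} s))) (sym (∣⁅x⁆∣≡1 s)) ≤-refl }

  attach : (P : PartialTree) → let open PartialTree P in ∀ {a c} →
           a ∈ W tree → c ∉ W tree → c ∈ S → Edge G a c → PartialTree
  attach P {a} {c} a∈W c∉W c∈S ac = record
    { tree = H⁺ ; connected = connected⁺ connected
    ; within = λ x∈ → [ within , (λ { refl → c∈S }) ]′ (∈-∪⁅⁆⁻ (W tree) x∈)
    ; root = root ; root∈ = p⊆p∪q ⁅ c ⁆ root∈
    ; sparse = subst (suc (edgeCount H⁺) ≤_) (sym (card-add (W tree) c∉W))
                     (s≤s (≤-trans edgeCount⁺ sparse)) }
    where
    open PartialTree P
    open Extend tree ac a∈W c∉W

  SpanningTreeOf : Set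
  SpanningTreeOf = Σ (Subgraph G) λ H → ConnectedSub H × W H ≡ S × suc (edgeCount H) ≤ ∣ S ∣

  -- Keep attaching vertices of S; connectivity of G[S] always provides an
  -- edge leaving the tree until it covers S.
  spanningTree : PartialTree → SpanningTreeOf
  spanningTree =
    upwardInduction size (λ P → ∣p∣≤n (W (PartialTree.tree P))) (λ _ → SpanningTreeOf) attachStep
    where
    edgeAvoid? : ∀ u v → Dec (EdgeAvoid G (∁ S) u v)
    edgeAvoid? u v = (Adj G u v Bool.≟ true) ×-dec ¬? (u ∈? ∁ S) ×-dec ¬? (v ∈? ∁ S)
    attachStep : ∀ P → (∀ P′ → size P < size P′ → SpanningTreeOf) → SpanningTreeOf
    attachStep P ih = finishOrExtend (⊆-or-escapes S (W tree))
      where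
      open PartialTree P
      attachAcross : Crossing (EdgeAvoid G (∁ S)) (W tree) → SpanningTreeOf
      attachAcross (a , c , a∈W , c∉W , (ac , _ , c∉∁S)) =
        ih (attach P a∈W c∉W (x∉∁p⇒x∈p c∉∁S) ac) (≤-reflexive (sym (card-add (W tree) c∉W)))
      finishOrExtend : S ⊆ W tree ⊎ Σ (Fin n) (λ b → b ∈ S × b ∉ W tree) → SpanningTreeOf
      finishOrExtend (inj₁ S⊆W) =
        let W≡S = ⊆-antisym within S⊆W
        in tree , connected , W≡S , subst (suc (edgeCount tree) ≤_) (cong ∣_∣ W≡S) sparse
      finishOrExtend (inj₂ (b , b∈S , b∉W)) =
        attachAcross (crossing-¬¬ edgeAvoid? root∈ b∉W (connS root b (within root∈) b∈S))

steinerDistance-induced :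
  ∀ {G : Graph n} (S : Subset n) →
  InducedConnected G S →
  ∀ {s} → s ∈ S → IsSteinerDistance G S (∣ S ∣ ∸ 1)
steinerDistance-induced S connS s∈S with spanningTree (seed s∈S)
  where open SpanningTree S connS
... | H , connH , W≡S , sparse = (H , connH , ⊆-reflexive , edges) , lower
  where
  ⊆-reflexive : S ⊆ W H
  ⊆-reflexive x∈S = subst (_ ∈_) (sym W≡S) x∈S
  atLeast : ∀ H′ → ConnectedSub H′ → S ⊆ W H′ → ∣ S ∣ ≤ suc (edgeCount H′)
  atLeast H′ connH′ S⊆W′ = ≤-trans (p⊆q⇒∣p∣≤∣q∣ S⊆W′) (connected-edges H′ connH′ (S⊆W′ s∈S))
  edges : edgeCount H ≡ ∣ S ∣ ∸ 1
  edges = cong pred (≤-antisym sparse (atLeast H connH ⊆-reflexive))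
  lower : ∀ H′ → ConnectedSub H′ → S ⊆ W H′ → ∣ S ∣ ∸ 1 ≤ edgeCount H′
  lower H′ connH′ S⊆W′ = ∸-monoˡ-≤ 1 (atLeast H′ connH′ S⊆W′)

steinerDistance-≤ : ∀ {G : Graph n} {S d d′} →
                    IsSteinerDistance G S d → IsSteinerDistance G S d′ → d ≤ d′
steinerDistance-≤ (_ , minimal) ((H , connH , S⊆W , edges) , _) =
  subst (_ ≤_) edges (minimal H connH S⊆W)

fewerThanκ : ∀ {G : Graph n} {κ} → IsVertexConnectivity G κ → ∀ {X : Subset n} → ∣ X ∣ < κ →
             ∀ {u v} → u ∉ X → v ∉ X → ¬ ¬ Reach (EdgeAvoid G X) u v
fewerThanκ (_ , minimal) {X} small {u} {v} u∉X v∉X noWalk =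
  <⇒≱ small (minimal X (inj₂ (u , v , u∉X , v∉X , noWalk)))

complement-small : ∀ {κ k} → n ∸ κ + 1 ≤ k → k ≤ n → n ∸ k < κ
complement-small {n} {κ} {k} bound k≤n = ≰⇒> λ κ≤n∸k →
  <⇒≱ (subst (_≤ k) (+-comm (n ∸ κ) 1) bound)
      (subst (_≤ n ∸ κ) (m∸[m∸n]≡n k≤n) (∸-monoʳ-≤ n κ≤n∸k))

mainTheorem12 : (n : ℕ) (G : Graph n) (κ k : ℕ) → Connected G →
    IsVertexConnectivity G κ → 2 ≤ k → n ∸ κ + 1 ≤ k → k ≤ n →
    IsSteinerDiameter G k (k ∸ 1)
mainTheorem12 n G κ k _ κ-conn 2≤k bound k≤n =
  (S₀ , ∣S₀∣≡k , distance S₀ ∣S₀∣≡k) ,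
  λ S d ∣S∣≡k d-is → steinerDistance-≤ d-is (distance S ∣S∣≡k)
  where
  S₀ : Subset n
  S₀ = proj₁ (subsetOfSize k≤n)
  ∣S₀∣≡k : ∣ S₀ ∣ ≡ k
  ∣S₀∣≡k = proj₂ (subsetOfSize k≤n)
  distance : ∀ S → ∣ S ∣ ≡ k → IsSteinerDistance G S (k ∸ 1)
  distance S ∣S∣≡k =
    subst (λ m → IsSteinerDistance G S (m ∸ 1)) ∣S∣≡k
      (steinerDistance-induced S induced-connected (proj₂ (nonempty-of-size S 0<∣S∣)))
    where
    0<∣S∣ : 0 < ∣ S ∣
    0<∣S∣ = subst (0 <_) (sym ∣S∣≡k) (≤-trans (s≤s z≤n) 2≤k)
    small : ∣ ∁ S ∣ < κ
    small = subst (_< κ) (sym (trans (∣∁p∣≡n∸∣p∣ S) (cong (n ∸_) ∣S∣≡k)))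
                  (complement-small bound k≤n)
    induced-connected : InducedConnected G S
    induced-connected u v u∈S v∈S =
      fewerThanκ {G = G} κ-conn small (x∈p⇒x∉∁p {p = S} u∈S) (x∈p⇒x∉∁p {p = S} v∈S)
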